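{- If $m\ge 2$ and $n\ge 2m-2$, then $\underline{{\rm gp}}_{\rm S}(K_m,K_n)=m(n-m+1)$.
   Context: $K_m$ is the complete graph on $m$ vertices. A set $X$ of vertices of a connected graph is a general position set if no shortest path contains more than two vertices of $X$; ${\rm gp}$ denotes the maximum cardinality of a general position set. For graphs $G,H$ and $f\colon V(G)\to V(H)$, the Sierpiński product $G\otimes_f H$ has vertex set $V(G)\times V(H)$ and edges $(g,h)(g,h')$ for $g\in V(G)$, $hh'\in E(H)$, and $(g,f(g'))(g',f(g))$ for $gg'\in E(G)$. $\underline{{\rm gp}}_{\rm S}(G,H)=\min_f{\rm gp}(G\otimes_f H)$ over all functions $f\colon V(G)\to V(H)$. -}

module Defs where

open import Level using (0ℓ)
open import Data.Nat using (ℕ; zero; suc; _+_; _≤_)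
open import Data.Fin using (Fin)
open import Data.Product using (_×_; _,_; Σ; ∃)
open import Data.Sum using (_⊎_)
open import Data.List using (List; []; _∷_; length)
open import Data.List.Membership.Propositional using (_∈_)
open import Data.List.Relation.Unary.Unique.Propositional using (Unique)
open import Data.Empty using (⊥)
open import Relation.Nullary using (¬_)
open import Relation.Binary.PropositionalEquality using (_≡_; _≢_)

record Graph : Set₁ where
  field
    V : Set
    E : V → V → Set
open Graph public

K : ℕ → Graph
K m = record { V = Fin m ; E = λ i j → i ≢ j }

Sierpinski : (G H : Graph) → (V G → V H) → Graph
Sierpinski G H f = record
  { V = V G × V H
  ; E = λ { (g , h) (g' , h') →
              (g ≡ g' × E H h h')
            ⊎ (E G g g' × (h ≡ f g' × h' ≡ f g)) } }

data Walk (G : Graph) : V G → V G → Set where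
  [] : ∀ {u} → Walk G u u
  _∷_ : ∀ {u w v} → E G u w → Walk G w v → Walk G u v

len : ∀ {G u v} → Walk G u v → ℕ
len [] = 0
len (_ ∷ p) = suc (len p)

verts : ∀ {G u v} → Walk G u v → List (V G)
verts {u = u} [] = u ∷ []
verts {u = u} (_ ∷ p) = u ∷ verts p

IsShortest : ∀ {G u v} → Walk G u v → Set
IsShortest {G} {u} {v} p = ∀ (q : Walk G u v) → len p ≤ len q

IsGPSet : (G : Graph) → List (V G) → Set
IsGPSet G X =
  Unique X ×
  (∀ {u v} (p : Walk G u v) → IsShortest p →
     ∀ x y z → x ∈ X → y ∈ X → z ∈ X →
     x ≢ y → y ≢ z → x ≢ z →
     x ∈ verts p → y ∈ verts p → z ∈ verts p → ⊥)

GPNumber : Graph → ℕ → Set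
GPNumber G k =
  (Σ (List (V G)) λ X → IsGPSet G X × length X ≡ k) ×
  (∀ X → IsGPSet G X → length X ≤ k)

LowerGPS : Graph → Graph → ℕ → Set
LowerGPS G H k =
  (Σ (V G → V H) λ f → GPNumber (Sierpinski G H f) k) ×
  (∀ (f : V G → V H) k' → GPNumber (Sierpinski G H f) k' → k ≤ k')

-- A vertex (g , h) of K_m ⊗_f K_n is a bridge end if h = f g′ for some g′ ≢ g, i.e. if it
-- lies on one of the edges (g , f g′)(g′ , f g) joining two copies of K_n.
--
-- Lower bound, for every f: a vertex that is not a bridge end has all its neighbours in its
-- own copy, a clique, so it is simplicial; simplicial vertices can only be endpoints of
-- shortest paths, so the non-bridge vertices are in general position.  A copy holds at most
-- m − 1 bridge ends, hence at least n + 1 − m non-bridge vertices.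
--
-- Upper bound, for the injective f₀ g = g ↑ˡ r with n = m + r: let X be in general position.
-- If copy g meets X in a bridge end (g , f₀ g′) and in a second vertex, the shortest path from
-- that vertex through the bridge into copy g′ shows that copy g′ misses X.  So a copy meeting X
-- at least twice meets it in at most (r + 1) + e vertices, e being the number of copies missing
-- X, and with k occupied copies |X| ≤ k (r + 1 + e) ≤ (k + e)(r + 1) = m (r + 1): if e ≥ 1 then
-- k ≤ m − 1 ≤ r + 1, which is where n ≥ 2m − 2 is used.

module Submission where

open import Defs
open import Level using (Level)
open import Data.Nat using (ℕ; zero; suc; _+_; _*_; _∸_; _≤_; _<_; z≤n; s≤s; s≤s⁻¹)
open import Data.Nat.Properties hiding (_≟_)
open import Data.Nat.Properties using () renaming (_≟_ to _≟ℕ_)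
open import Data.Bool using (if_then_else_)
open import Data.Empty using (⊥)
open import Data.Fin using (Fin; zero; suc; _↑ˡ_; _↑ʳ_; punchIn)
open import Data.Fin.Properties using (_≟_; any?; punchInᵢ≢i; ↑ˡ-injective)
open import Data.List using (List; []; _∷_; length; filter; cartesianProduct; allFin)
open import Data.List.Membership.Propositional using (_∈_; _∉_)
open import Data.List.Membership.Propositional.Properties
  using (∈-filter⁺; ∈-filter⁻; ∈-allFin; ∈-cartesianProduct⁺)
import Data.List.Relation.Unary.Any as Any
open import Data.List.Relation.Unary.Any using (here; there)
open import Data.List.Relation.Unary.All.Properties using (All¬⇒¬Any)
open import Data.List.Relation.Unary.Unique.Propositional using (Unique; []; _∷_)
open import Data.List.Relation.Unary.Unique.Propositional.Properties
  using (filter⁺; cartesianProduct⁺; allFin⁺)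
open import Data.Product using (_×_; _,_; proj₁; proj₂; ∃; Σ)
open import Data.Product.Properties using (≡-dec; ×-≡,≡→≡; ×-≡,≡←≡)
open import Data.Sum using (_⊎_; inj₁; inj₂)
open import Function using (_∘_)
open import Algebra.Properties.CommutativeSemigroup +-commutativeSemigroup using (x∙yz≈y∙xz)
open import Function.Definitions using (Injective)
open import Relation.Binary.Definitions using (DecidableEquality)
open import Relation.Binary.PropositionalEquality
open import Relation.Nullary using (Dec; yes; no; does; ¬_; ¬?; contradiction)
open import Relation.Nullary.Decidable using (_×-dec_; _⊎-dec_)
open import Relation.Unary using (Pred; Decidable)
open import Algebra.Properties.Semiring.Sum +-*-semiring
  using (sum; sum-syntax; sum-cong-≗; sum-remove; ∑-distrib-+; ∑-comm; *-distribˡ-sum; *-distribʳ-sum)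

private variable
  a b ℓ : Level
  A : Set a
  B : Set b
  k m n r : ℕ

-- Finite sums and counting over Fin

∑-const : ∀ n c → ∑[ i < n ] c ≡ n * c
∑-const zero    c = refl
∑-const (suc n) c = cong (c +_) (∑-const n c)

∑-zero : (t : Fin n → ℕ) → (∀ i → t i ≡ 0) → sum t ≡ 0
∑-zero {n} _ t≡0 = trans (sum-cong-≗ t≡0) (trans (∑-const n 0) (*-zeroʳ n))

∑-mono-≤ : {s t : Fin n → ℕ} → (∀ i → s i ≤ t i) → sum s ≤ sum t
∑-mono-≤ {zero}  _   = z≤n
∑-mono-≤ {suc n} s≤t = +-mono-≤ (s≤t zero) (∑-mono-≤ (s≤t ∘ suc))

term≤∑ : (t : Fin n → ℕ) (i : Fin n) → t i ≤ sum t
term≤∑ {suc n} t i = ≤-trans (m≤m+n (t i) _) (≤-reflexive (sym (sum-remove {i = i} t)))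

∑≤term+∑ : (s t : Fin n → ℕ) (i : Fin n) → (∀ j → j ≢ i → s j ≤ t j) → sum s ≤ s i + sum t
∑≤term+∑ {suc n} s t i s≤t = begin
  sum s                              ≡⟨ sum-remove {i = i} s ⟩
  s i + ∑[ j < n ] s (punchIn i j)   ≤⟨ +-monoʳ-≤ (s i) (∑-mono-≤ λ j → s≤t (punchIn i j) (punchInᵢ≢i i j)) ⟩
  s i + ∑[ j < n ] t (punchIn i j)   ≤⟨ +-monoʳ-≤ (s i) (m≤n+m _ (t i)) ⟩
  s i + (t i + ∑[ j < n ] t (punchIn i j)) ≡⟨ cong (s i +_) (sum-remove {i = i} t) ⟨
  s i + sum t                        ∎
  where open ≤-Reasoning

∑-split : ∀ m (t : Fin (m + r) → ℕ) → sum t ≡ ∑[ i < m ] t (i ↑ˡ r) + ∑[ j < r ] t (m ↑ʳ j)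
∑-split zero    t = refl
∑-split (suc m) t = trans (cong (t zero +_) (∑-split m (t ∘ suc))) (sym (+-assoc (t zero) _ _))

𝟙 : Dec A → ℕ
𝟙 A? = if does A? then 1 else 0

𝟙≤1 : (A? : Dec A) → 𝟙 A? ≤ 1
𝟙≤1 (yes _) = ≤-refl
𝟙≤1 (no _)  = z≤n

𝟙-yes : A → (A? : Dec A) → 𝟙 A? ≡ 1
𝟙-yes _ (yes _) = refl
𝟙-yes a (no ¬a) = contradiction a ¬a

𝟙-no : ¬ A → (A? : Dec A) → 𝟙 A? ≡ 0
𝟙-no ¬a (yes a) = contradiction a ¬a
𝟙-no _  (no _)  = refl

𝟙-⇔ : (A → B) → (B → A) → (A? : Dec A) (B? : Dec B) → 𝟙 A? ≡ 𝟙 B?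
𝟙-⇔ A→B _   (yes a)  B? = sym (𝟙-yes (A→B a) B?)
𝟙-⇔ _   B→A (no ¬a) B? = sym (𝟙-no (¬a ∘ B→A) B?)

𝟙-× : (A? : Dec A) (B? : Dec B) → 𝟙 (A? ×-dec B?) ≡ 𝟙 A? * 𝟙 B?
𝟙-× (yes _) (yes _) = refl
𝟙-× (yes _) (no _)  = refl
𝟙-× (no _)  _       = refl

𝟙-⊎ : ¬ (A × B) → (A? : Dec A) (B? : Dec B) → 𝟙 (A? ⊎-dec B?) ≡ 𝟙 A? + 𝟙 B?
𝟙-⊎ disjoint (yes a) (yes b) = contradiction (a , b) disjoint
𝟙-⊎ _        (yes _) (no _)  = refl
𝟙-⊎ _        (no _)  (yes _) = refl
𝟙-⊎ _        (no _)  (no _)  = refl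

𝟙+𝟙¬ : (A? : Dec A) → 𝟙 A? + 𝟙 (¬? A?) ≡ 1
𝟙+𝟙¬ (yes _) = refl
𝟙+𝟙¬ (no _)  = refl

count : {P : Pred (Fin n) ℓ} → Decidable P → ℕ
count {n} P? = ∑[ i < n ] 𝟙 (P? i)

count≤n : {P : Pred (Fin n) ℓ} (P? : Decidable P) → count P? ≤ n
count≤n {n} P? = ≤-trans (∑-mono-≤ (𝟙≤1 ∘ P?)) (≤-reflexive (trans (∑-const n 1) (*-identityʳ n)))

count-cong : {P : Pred (Fin n) a} {Q : Pred (Fin n) b} (P? : Decidable P) (Q? : Decidable Q) →
             (∀ i → P i → Q i) → (∀ i → Q i → P i) → count P? ≡ count Q?
count-cong P? Q? P⇒Q Q⇒P = sum-cong-≗ λ i → 𝟙-⇔ (P⇒Q i) (Q⇒P i) (P? i) (Q? i)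

count+count¬ : {P : Pred (Fin n) ℓ} (P? : Decidable P) → count P? + count (λ i → ¬? (P? i)) ≡ n
count+count¬ {n} P? = begin
  count P? + count (λ i → ¬? (P? i))     ≡⟨ ∑-distrib-+ (λ i → 𝟙 (P? i)) (λ i → 𝟙 (¬? (P? i))) ⟨
  ∑[ i < n ] (𝟙 (P? i) + 𝟙 (¬? (P? i))) ≡⟨ sum-cong-≗ (𝟙+𝟙¬ ∘ P?) ⟩
  ∑[ i < n ] 1                         ≡⟨ ∑-const n 1 ⟩
  n * 1                                ≡⟨ *-identityʳ n ⟩
  n                                    ∎
  where open ≡-Reasoning

count-≟ : (j : Fin n) → count (_≟ j) ≡ 1
count-≟ {suc n} zero    = cong suc (∑-zero {n} (λ _ → 0) λ _ → refl)
count-≟ {suc n} (suc j) = count-≟ j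

1+count≢≡n : (j : Fin n) → 1 + count (λ i → ¬? (i ≟ j)) ≡ n
1+count≢≡n {n} j = begin
  1 + count (λ i → ¬? (i ≟ j))             ≡⟨ cong (_+ count (λ i → ¬? (i ≟ j))) (count-≟ j) ⟨
  count (_≟ j) + count (λ i → ¬? (i ≟ j))  ≡⟨ count+count¬ (_≟ j) ⟩
  n                                        ∎
  where open ≡-Reasoning

∑∑𝟙*𝟙≟≡count : {P : Pred (Fin k) ℓ} (P? : Decidable P) (F : Fin k → Fin n) →
                    ∑[ i < k ] ∑[ h < n ] (𝟙 (P? i) * 𝟙 (h ≟ F i)) ≡ count P?
∑∑𝟙*𝟙≟≡count {n = n} P? F = sum-cong-≗ λ i → begin
  ∑[ h < n ] (𝟙 (P? i) * 𝟙 (h ≟ F i)) ≡⟨ *-distribˡ-sum (𝟙 (P? i)) (λ h → 𝟙 (h ≟ F i)) ⟨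
  𝟙 (P? i) * count (_≟ F i)         ≡⟨ cong (𝟙 (P? i) *_) (count-≟ (F i)) ⟩
  𝟙 (P? i) * 1                      ≡⟨ *-identityʳ _ ⟩
  𝟙 (P? i)                          ∎
  where open ≡-Reasoning

1≤count⇒∃ : {P : Pred (Fin n) ℓ} (P? : Decidable P) → 1 ≤ count P? → ∃ P
1≤count⇒∃ P? 1≤count with any? P?
... | yes ∃P = ∃P
... | no  ∄P = contradiction (≤-trans 1≤count (≤-reflexive count≡0)) λ ()
  where
  count≡0 : count P? ≡ 0
  count≡0 = ∑-zero (λ i → 𝟙 (P? i)) λ i → 𝟙-no (∄P ∘ (i ,_)) (P? i)

2≤count⇒∃≢ : {P : Pred (Fin n) ℓ} (P? : Decidable P) → 2 ≤ count P? → ∀ i → ∃ λ j → j ≢ i × P j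
2≤count⇒∃≢ {n} P? 2≤count i with any? (λ j → ¬? (j ≟ i) ×-dec P? j)
... | yes ∃P = ∃P
... | no  ∄P = contradiction (≤-trans 2≤count count≤1) λ { (s≤s ()) }
  where
  count≤1 : count P? ≤ 1
  count≤1 = begin
    count P?
      ≤⟨ ∑≤term+∑ _ (λ _ → 0) i (λ j j≢i → ≤-reflexive (𝟙-no (λ Pj → ∄P (j , j≢i , Pj)) (P? j))) ⟩
    𝟙 (P? i) + ∑[ j < n ] 0
      ≤⟨ +-mono-≤ (𝟙≤1 (P? i)) (≤-reflexive (∑-zero {n} (λ _ → 0) λ _ → refl)) ⟩
    1                             ∎
    where open ≤-Reasoning

count-image≤ : {Q : Pred (Fin k) ℓ} (Q? : Decidable Q) (F : Fin k → Fin n) →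
               count (λ h → any? λ i → Q? i ×-dec h ≟ F i) ≤ count Q?
count-image≤ {k} {n = n} Q? F = begin
  count (λ h → any? λ i → Q? i ×-dec h ≟ F i)    ≤⟨ ∑-mono-≤ hit≤ ⟩
  ∑[ h < n ] ∑[ i < k ] (𝟙 (Q? i) * 𝟙 (h ≟ F i))  ≡⟨ ∑-comm (λ h i → 𝟙 (Q? i) * 𝟙 (h ≟ F i)) ⟩
  ∑[ i < k ] ∑[ h < n ] (𝟙 (Q? i) * 𝟙 (h ≟ F i))  ≡⟨ ∑∑𝟙*𝟙≟≡count Q? F ⟩
  count Q?                                       ∎
  where
  open ≤-Reasoning
  hit≤ : ∀ h → 𝟙 (any? λ i → Q? i ×-dec h ≟ F i) ≤ ∑[ i < k ] (𝟙 (Q? i) * 𝟙 (h ≟ F i))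
  hit≤ h with any? (λ i → Q? i ×-dec h ≟ F i)
  ... | no  _                = z≤n
  ... | yes (i , Qi , h≡Fi) = begin
    1                         ≡⟨ cong₂ _*_ (𝟙-yes Qi (Q? i)) (𝟙-yes h≡Fi (h ≟ F i)) ⟨
    𝟙 (Q? i) * 𝟙 (h ≟ F i)    ≤⟨ term≤∑ _ i ⟩
    ∑[ i < k ] (𝟙 (Q? i) * 𝟙 (h ≟ F i)) ∎

_≟ᵥ_ : DecidableEquality (Fin m × Fin n)
_≟ᵥ_ = ≡-dec _≟_ _≟_

_∈ᵥ?_ : (v : Fin m × Fin n) (X : List (Fin m × Fin n)) → Dec (v ∈ X)
v ∈ᵥ? X = Any.any? (v ≟ᵥ_) X

copySize : List (Fin m × Fin n) → Fin m → ℕ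
copySize X g = count (λ h → (g , h) ∈ᵥ? X)

∑count≟ᵥ≡1 : (x : Fin m × Fin n) → ∑[ g < m ] count (λ h → (g , h) ≟ᵥ x) ≡ 1
∑count≟ᵥ≡1 {m} {n} (g₀ , h₀) = begin
  ∑[ g < m ] ∑[ h < n ] 𝟙 ((g , h) ≟ᵥ (g₀ , h₀))  ≡⟨ sum-cong-≗ (λ g → sum-cong-≗ λ h → pair g h) ⟩
  ∑[ g < m ] ∑[ h < n ] (𝟙 (g ≟ g₀) * 𝟙 (h ≟ h₀))  ≡⟨ ∑∑𝟙*𝟙≟≡count (_≟ g₀) (λ _ → h₀) ⟩
  count (_≟ g₀)                                 ≡⟨ count-≟ g₀ ⟩
  1                                             ∎
  where
  open ≡-Reasoning
  pair : ∀ g h → 𝟙 ((g , h) ≟ᵥ (g₀ , h₀)) ≡ 𝟙 (g ≟ g₀) * 𝟙 (h ≟ h₀)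
  pair g h = trans (𝟙-⇔ ×-≡,≡←≡ ×-≡,≡→≡ ((g , h) ≟ᵥ (g₀ , h₀)) (g ≟ g₀ ×-dec h ≟ h₀))
                   (𝟙-× (g ≟ g₀) (h ≟ h₀))

length≡∑copySize : {X : List (Fin m × Fin n)} → Unique X → length X ≡ ∑[ g < m ] copySize X g
length≡∑copySize {m} {n} [] = sym (∑-zero {m} (λ _ → ∑[ h < n ] 0) λ _ → ∑-zero {n} (λ _ → 0) λ _ → refl)
length≡∑copySize {m} {n} {x ∷ X} (x∉X ∷ X-unique) = begin
  1 + length X
    ≡⟨ cong₂ _+_ (sym (∑count≟ᵥ≡1 x)) (length≡∑copySize X-unique) ⟩
  ∑[ g < m ] count (λ h → (g , h) ≟ᵥ x) + ∑[ g < m ] copySize X g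
    ≡⟨ ∑-distrib-+ (λ g → count (λ h → (g , h) ≟ᵥ x)) (copySize X) ⟨
  ∑[ g < m ] (count (λ h → (g , h) ≟ᵥ x) + copySize X g)
    ≡⟨ sum-cong-≗ (λ g → ∑-distrib-+ (λ h → 𝟙 ((g , h) ≟ᵥ x)) (λ h → 𝟙 ((g , h) ∈ᵥ? X))) ⟨
  ∑[ g < m ] ∑[ h < n ] (𝟙 ((g , h) ≟ᵥ x) + 𝟙 ((g , h) ∈ᵥ? X))
    ≡⟨ sum-cong-≗ (λ g → sum-cong-≗ λ h → 𝟙-⊎ disjoint ((g , h) ≟ᵥ x) ((g , h) ∈ᵥ? X)) ⟨
  ∑[ g < m ] copySize (x ∷ X) g
    ∎
  where
  open ≡-Reasoning
  disjoint : ∀ {v} → ¬ (v ≡ x × v ∈ X)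
  disjoint (refl , x∈X) = All¬⇒¬Any x∉X x∈X

-- Simplicial vertices and general position

Simplicial : (G : Graph) → V G → Set
Simplicial G x = ∀ {u v} → E G u x → E G x v → u ≡ v ⊎ E G u v

1≤len : ∀ {G u v} (p : Walk G u v) → u ≢ v → 1 ≤ len p
1≤len []      u≢u = contradiction refl u≢u
1≤len (_ ∷ _) _   = s≤s z≤n

shortcut-through : ∀ {G u w v} → E G u w → Simplicial G w → (p : Walk G w v) →
                   w ≡ v ⊎ Σ (Walk G u v) (λ q → len q < suc (len p))
shortcut-through _ _ [] = inj₁ refl
shortcut-through e w-simplicial (e′ ∷ p) with w-simplicial e e′
... | inj₁ refl = inj₂ (p , m<n⇒m<1+n (n<1+n (len p)))
... | inj₂ e″   = inj₂ (e″ ∷ p , ≤-refl)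

simplicial-endpoint-or-shortcut : ∀ {G u v x} (p : Walk G u v) → x ∈ verts p → Simplicial G x →
                                  x ≡ u ⊎ x ≡ v ⊎ Σ (Walk G u v) (λ q → len q < len p)
simplicial-endpoint-or-shortcut []      (here refl) _ = inj₁ refl
simplicial-endpoint-or-shortcut (_ ∷ _) (here refl) _ = inj₁ refl
simplicial-endpoint-or-shortcut (e ∷ p) (there x∈p) x-simplicial
  with simplicial-endpoint-or-shortcut p x∈p x-simplicial
... | inj₁ refl                = inj₂ (shortcut-through e x-simplicial p)
... | inj₂ (inj₁ x≡v)         = inj₂ (inj₁ x≡v)
... | inj₂ (inj₂ (q , q<p))   = inj₂ (inj₂ (e ∷ q , s≤s q<p))

shortest-simplicial⇒endpoint : ∀ {G u v x} (p : Walk G u v) → IsShortest p →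
                               x ∈ verts p → Simplicial G x → x ≡ u ⊎ x ≡ v
shortest-simplicial⇒endpoint p p-shortest x∈p x-simplicial
  with simplicial-endpoint-or-shortcut p x∈p x-simplicial
... | inj₁ x≡u               = inj₁ x≡u
... | inj₂ (inj₁ x≡v)        = inj₂ x≡v
... | inj₂ (inj₂ (q , q<p))  = contradiction (p-shortest q) (<⇒≱ q<p)

no-three-distinct-in-pair : {u v x y z : A} → x ≡ u ⊎ x ≡ v → y ≡ u ⊎ y ≡ v → z ≡ u ⊎ z ≡ v →
                            x ≢ y → y ≢ z → x ≢ z → ⊥
no-three-distinct-in-pair (inj₁ refl) (inj₁ refl) _           x≢y _   _   = x≢y refl
no-three-distinct-in-pair (inj₂ refl) (inj₂ refl) _           x≢y _   _   = x≢y refl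
no-three-distinct-in-pair (inj₁ refl) (inj₂ refl) (inj₁ refl) _   _   x≢z = x≢z refl
no-three-distinct-in-pair (inj₁ refl) (inj₂ refl) (inj₂ refl) _   y≢z _   = y≢z refl
no-three-distinct-in-pair (inj₂ refl) (inj₁ refl) (inj₁ refl) _   y≢z _   = y≢z refl
no-three-distinct-in-pair (inj₂ refl) (inj₁ refl) (inj₂ refl) _   _   x≢z = x≢z refl

simplicial⇒gp : ∀ {G X} → Unique X → (∀ {x} → x ∈ X → Simplicial G x) → IsGPSet G X
simplicial⇒gp {G} {X} X-unique X-simplicial =
  X-unique , λ p p-shortest x y z x∈X y∈X z∈X x≢y y≢z x≢z x∈p y∈p z∈p →
    no-three-distinct-in-pair (endpoint p p-shortest x∈X x∈p) (endpoint p p-shortest y∈X y∈p)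
                              (endpoint p p-shortest z∈X z∈p) x≢y y≢z x≢z
  where
  endpoint : ∀ {u v x} (p : Walk G u v) → IsShortest p → x ∈ X → x ∈ verts p → x ≡ u ⊎ x ≡ v
  endpoint p p-shortest x∈X x∈p = shortest-simplicial⇒endpoint p p-shortest x∈p (X-simplicial x∈X)

-- Non-bridge vertices of K_m ⊗_f K_n

K⊗K : (Fin m → Fin n) → Graph
K⊗K {m} {n} f = Sierpinski (K m) (K n) f

module _ {m n : ℕ} (f : Fin m → Fin n) where

  IsBridgeEnd : Fin m × Fin n → Set
  IsBridgeEnd (g , h) = ∃ λ g′ → g′ ≢ g × h ≡ f g′

  isBridgeEnd? : Decidable IsBridgeEnd
  isBridgeEnd? (g , h) = any? λ g′ → ¬? (g′ ≟ g) ×-dec h ≟ f g′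

  nonBridge⇒simplicial : ∀ {v} → ¬ IsBridgeEnd v → Simplicial (K⊗K f) v
  nonBridge⇒simplicial ¬bridge (inj₂ (g′≢g , _ , h≡fg′)) _ = contradiction (_ , g′≢g , h≡fg′) ¬bridge
  nonBridge⇒simplicial ¬bridge _ (inj₂ (g≢g′ , h≡fg′ , _)) = contradiction (_ , g≢g′ ∘ sym , h≡fg′) ¬bridge
  nonBridge⇒simplicial _ {_ , h₁} {_ , h₂} (inj₁ (refl , _)) (inj₁ (refl , _)) with h₁ ≟ h₂
  ... | yes refl    = inj₁ refl
  ... | no  h₁≢h₂ = inj₂ (inj₁ (refl , h₁≢h₂))

  isNonBridge? : Decidable (λ v → ¬ IsBridgeEnd v)
  isNonBridge? v = ¬? (isBridgeEnd? v)

  vertices : List (Fin m × Fin n)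
  vertices = cartesianProduct (allFin m) (allFin n)

  nonBridgeVertices : List (Fin m × Fin n)
  nonBridgeVertices = filter isNonBridge? vertices

  ∈-nonBridgeVertices⁻ : ∀ {v} → v ∈ nonBridgeVertices → ¬ IsBridgeEnd v
  ∈-nonBridgeVertices⁻ = proj₂ ∘ ∈-filter⁻ isNonBridge? {xs = vertices}

  ∈-nonBridgeVertices⁺ : ∀ {v} → ¬ IsBridgeEnd v → v ∈ nonBridgeVertices
  ∈-nonBridgeVertices⁺ {g , h} = ∈-filter⁺ isNonBridge? (∈-cartesianProduct⁺ (∈-allFin g) (∈-allFin h))

  nonBridgeVertices-unique : Unique nonBridgeVertices
  nonBridgeVertices-unique = filter⁺ isNonBridge? (cartesianProduct⁺ (allFin⁺ m) (allFin⁺ n))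

  nonBridgeVertices-gp : IsGPSet (K⊗K f) nonBridgeVertices
  nonBridgeVertices-gp = simplicial⇒gp nonBridgeVertices-unique (nonBridge⇒simplicial ∘ ∈-nonBridgeVertices⁻)

  n+1≤m+count-nonBridge : ∀ g → n + 1 ≤ m + count (λ h → isNonBridge? (g , h))
  n+1≤m+count-nonBridge g = begin
    n + 1                                            ≡⟨ +-comm n 1 ⟩
    1 + n                                            ≡⟨ cong (1 +_) (count+count¬ (λ h → isBridgeEnd? (g , h))) ⟨
    1 + (count (λ h → isBridgeEnd? (g , h)) + nonBridges)
      ≤⟨ +-monoʳ-≤ 1 (+-monoˡ-≤ nonBridges (count-image≤ (λ g′ → ¬? (g′ ≟ g)) f)) ⟩
    1 + (others + nonBridges)                        ≡⟨ +-assoc 1 others nonBridges ⟨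
    1 + others + nonBridges                          ≡⟨ cong (_+ nonBridges) (1+count≢≡n g) ⟩
    m + nonBridges                                   ∎
    where
    open ≤-Reasoning
    nonBridges others : ℕ
    nonBridges = count (λ h → isNonBridge? (g , h))
    others     = count (λ g′ → ¬? (g′ ≟ g))

  nonBridgeVertices-length : m * (n + 1 ∸ m) ≤ length nonBridgeVertices
  nonBridgeVertices-length = begin
    m * (n + 1 ∸ m)                                ≡⟨ ∑-const m (n + 1 ∸ m) ⟨
    ∑[ g < m ] (n + 1 ∸ m)                         ≤⟨ ∑-mono-≤ (λ g → m≤n+o⇒m∸n≤o (n + 1) m (n+1≤m+count-nonBridge g)) ⟩
    ∑[ g < m ] count (λ h → isNonBridge? (g , h))  ≡⟨ sum-cong-≗ (λ g → count-cong (λ h → isNonBridge? (g , h))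
                                                        (λ h → (g , h) ∈ᵥ? nonBridgeVertices)
                                                        (λ _ → ∈-nonBridgeVertices⁺) (λ _ → ∈-nonBridgeVertices⁻)) ⟩
    ∑[ g < m ] copySize nonBridgeVertices g        ≡⟨ length≡∑copySize nonBridgeVertices-unique ⟨
    length nonBridgeVertices                       ∎
    where open ≤-Reasoning

module _ {m n : ℕ} (f : Fin m → Fin n) where

  2≤len-from-nonBridge : ∀ {g h g′ h′} (p : Walk (K⊗K f) (g , h) (g′ , h′)) →
                         g ≢ g′ → h ≢ f g′ → 2 ≤ len p
  2≤len-from-nonBridge [] g≢g _ = contradiction refl g≢g
  2≤len-from-nonBridge (inj₁ (refl , _) ∷ p) g≢g′ _ = s≤s (1≤len p (g≢g′ ∘ cong proj₁))
  2≤len-from-nonBridge {g′ = g′} (_∷_ {w = g″ , _} (inj₂ (_ , h≡fg″ , _)) p) _ h≢fg′ with g″ ≟ g′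
  ... | yes refl   = contradiction h≡fg″ h≢fg′
  ... | no  g″≢g′ = s≤s (1≤len p (g″≢g′ ∘ cong proj₁))

  2≤len-into-nonBridge : ∀ {g h g′ h′} (p : Walk (K⊗K f) (g , h) (g′ , h′)) →
                         g ≢ g′ → h′ ≢ f g → 2 ≤ len p
  2≤len-into-nonBridge [] g≢g _ = contradiction refl g≢g
  2≤len-into-nonBridge (inj₁ (refl , _) ∷ p) g≢g′ _ = s≤s (1≤len p (g≢g′ ∘ cong proj₁))
  2≤len-into-nonBridge {g′ = g′} (_∷_ {w = g″ , _} (inj₂ (_ , _ , refl)) p) _ h′≢fg with g″ ≟ g′
  ... | yes refl   = s≤s (1≤len p (h′≢fg ∘ sym ∘ cong proj₂))
  ... | no  g″≢g′ = s≤s (1≤len p (g″≢g′ ∘ cong proj₁))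

  3≤len-between-nonBridges : Injective _≡_ _≡_ f → ∀ {g h g′ h′} (p : Walk (K⊗K f) (g , h) (g′ , h′)) →
                             g ≢ g′ → h ≢ f g′ → h′ ≢ f g → 3 ≤ len p
  3≤len-between-nonBridges _ [] g≢g _ _ = contradiction refl g≢g
  3≤len-between-nonBridges _ {g′ = g′} (_∷_ {w = _ , h₁} (inj₁ (refl , _)) p) g≢g′ _ h′≢fg with h₁ ≟ f g′
  ... | yes refl   = s≤s (2≤len-into-nonBridge p g≢g′ h′≢fg)
  ... | no  h₁≢fg′ = s≤s (2≤len-from-nonBridge p g≢g′ h₁≢fg′)
  3≤len-between-nonBridges f-injective (_∷_ {w = g″ , _} (inj₂ (_ , h≡fg″ , refl)) p) g≢g′ h≢fg′ _ =
    s≤s (2≤len-from-nonBridge p (λ { refl → h≢fg′ h≡fg″ }) (g≢g′ ∘ f-injective))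

  -- The path (g , h), (g , f g′), (g′ , f g), (g′ , h′), without its last step if h′ = f g,
  -- is a shortest path through three vertices of X.
  gp-bridge⇒far-copy-∉ : Injective _≡_ _≡_ f → ∀ {X} → IsGPSet (K⊗K f) X → ∀ {g g′ h h′} →
                         g ≢ g′ → (g , h) ∈ X → h ≢ f g′ → (g , f g′) ∈ X → (g′ , h′) ∉ X
  gp-bridge⇒far-copy-∉ f-injective (_ , gp) {g} {g′} {h} {h′} g≢g′ gh∈X h≢fg′ bridge∈X far∈X with h′ ≟ f g
  ... | yes refl = gp path (λ q → 2≤len-from-nonBridge q g≢g′ h≢fg′) _ _ _ gh∈X bridge∈X far∈X
                      (h≢fg′ ∘ cong proj₂) (g≢g′ ∘ cong proj₁) (g≢g′ ∘ cong proj₁)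
                      (here refl) (there (here refl)) (there (there (here refl)))
    where
    path : Walk (K⊗K f) (g , h) (g′ , f g)
    path = inj₁ (refl , h≢fg′) ∷ inj₂ (g≢g′ , refl , refl) ∷ []
  ... | no h′≢fg = gp path (λ q → 3≤len-between-nonBridges f-injective q g≢g′ h≢fg′ h′≢fg)
                      _ _ _ gh∈X bridge∈X far∈X
                      (h≢fg′ ∘ cong proj₂) (g≢g′ ∘ cong proj₁) (g≢g′ ∘ cong proj₁)
                      (here refl) (there (here refl)) (there (there (there (here refl))))
    where
    path : Walk (K⊗K f) (g , h) (g′ , h′)
    path = inj₁ (refl , h≢fg′) ∷ inj₂ (g≢g′ , refl , refl) ∷ inj₁ (refl , h′≢fg ∘ sym) ∷ []

-- General position sets for the embedding g ↦ g ↑ˡ r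

emptyCopies : List (Fin m × Fin n) → ℕ
emptyCopies X = count (λ g → copySize X g ≟ℕ 0)

k*[e+1+r]≤[e+k]*[1+r] : ∀ e k r → e + k ≤ 2 + r → k * (e + suc r) ≤ (e + k) * suc r
k*[e+1+r]≤[e+k]*[1+r] zero    k r _          = ≤-refl
k*[e+1+r]≤[e+k]*[1+r] (suc e) k r 1+e+k≤2+r = begin
  k * (suc e + suc r)          ≡⟨ *-distribˡ-+ k (suc e) (suc r) ⟩
  k * suc e + k * suc r        ≤⟨ +-monoˡ-≤ (k * suc r) (*-monoˡ-≤ (suc e) k≤1+r) ⟩
  suc r * suc e + k * suc r    ≡⟨ cong (_+ k * suc r) (*-comm (suc r) (suc e)) ⟩
  suc e * suc r + k * suc r    ≡⟨ *-distribʳ-+ (suc r) (suc e) k ⟨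
  (suc e + k) * suc r          ∎
  where
  open ≤-Reasoning
  k≤1+r : k ≤ suc r
  k≤1+r = ≤-trans (m≤n+m k e) (s≤s⁻¹ 1+e+k≤2+r)

module _ {m r : ℕ} {X : List (Fin m × Fin (m + r))} (X-gp : IsGPSet (K⊗K (_↑ˡ r)) X) where

  crowded⇒bridge∈≤empty : ∀ {g i} → 2 ≤ copySize X g → i ≢ g →
                          𝟙 ((g , i ↑ˡ r) ∈ᵥ? X) ≤ 𝟙 (copySize X i ≟ℕ 0)
  crowded⇒bridge∈≤empty {g} {i} crowded i≢g with (g , i ↑ˡ r) ∈ᵥ? X | copySize X i ≟ℕ 0
  ... | no _     | _           = z≤n
  ... | yes _    | yes i-empty = ≤-reflexive (sym (𝟙-yes i-empty (copySize X i ≟ℕ 0)))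
  ... | yes bridge∈X | no i-occupied
    with 2≤count⇒∃≢ (λ h → (g , h) ∈ᵥ? X) crowded (i ↑ˡ r)
       | 1≤count⇒∃ (λ h → (i , h) ∈ᵥ? X) (n≢0⇒n>0 i-occupied)
  ... | _ , h≢ , gh∈X | _ , far∈X =
    contradiction far∈X (gp-bridge⇒far-copy-∉ (_↑ˡ r) (↑ˡ-injective r _ _) X-gp (i≢g ∘ sym) gh∈X h≢ bridge∈X)

  crowded-copySize≤ : ∀ {g} → 2 ≤ copySize X g → copySize X g ≤ emptyCopies X + suc r
  crowded-copySize≤ {g} crowded = begin
    copySize X g
      ≡⟨ ∑-split m (λ h → 𝟙 ((g , h) ∈ᵥ? X)) ⟩
    ∑[ i < m ] 𝟙 ((g , i ↑ˡ r) ∈ᵥ? X) + count (λ j → (g , m ↑ʳ j) ∈ᵥ? X)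
      ≤⟨ +-mono-≤ (∑≤term+∑ _ _ g λ _ i≢g → crowded⇒bridge∈≤empty crowded i≢g)
                  (count≤n (λ j → (g , m ↑ʳ j) ∈ᵥ? X)) ⟩
    𝟙 ((g , g ↑ˡ r) ∈ᵥ? X) + emptyCopies X + r
      ≤⟨ +-monoˡ-≤ r (+-monoˡ-≤ (emptyCopies X) (𝟙≤1 ((g , g ↑ˡ r) ∈ᵥ? X))) ⟩
    suc (emptyCopies X + r)
      ≡⟨ +-suc (emptyCopies X) r ⟨
    emptyCopies X + suc r ∎
    where open ≤-Reasoning

  copySize≤ : ∀ g → copySize X g ≤ 𝟙 (¬? (copySize X g ≟ℕ 0)) * (emptyCopies X + suc r)
  copySize≤ g with copySize X g | crowded-copySize≤ {g}
  ... | zero          | _       = z≤n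
  ... | suc zero      | _       = subst (1 ≤_) (sym (*-identityˡ _)) (≤-trans (s≤s z≤n) (m≤n+m (suc r) (emptyCopies X)))
  ... | suc (suc k)   | crowded = subst (suc (suc k) ≤_) (sym (*-identityˡ _)) (crowded (s≤s (s≤s z≤n)))

  gp-length≤ : m ≤ 2 + r → length X ≤ m * suc r
  gp-length≤ m≤2+r = begin
    length X                                ≡⟨ length≡∑copySize (proj₁ X-gp) ⟩
    ∑[ g < m ] copySize X g                 ≤⟨ ∑-mono-≤ copySize≤ ⟩
    ∑[ g < m ] (𝟙 (occupied? g) * bound)    ≡⟨ *-distribʳ-sum bound (λ g → 𝟙 (occupied? g)) ⟨
    count occupied? * bound
      ≤⟨ k*[e+1+r]≤[e+k]*[1+r] (emptyCopies X) (count occupied?) r (≤-trans (≤-reflexive e+k≡m) m≤2+r) ⟩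
    (emptyCopies X + count occupied?) * suc r ≡⟨ cong (_* suc r) e+k≡m ⟩
    m * suc r                               ∎
    where
    open ≤-Reasoning
    bound : ℕ
    bound = emptyCopies X + suc r
    occupied? : Decidable (λ g → copySize X g ≢ 0)
    occupied? g = ¬? (copySize X g ≟ℕ 0)
    e+k≡m : emptyCopies X + count occupied? ≡ m
    e+k≡m = count+count¬ (λ g → copySize X g ≟ℕ 0)

lowerGPS-intro : ∀ {G H k} (f₀ : V G → V H) →
                 (∀ X → IsGPSet (Sierpinski G H f₀) X → length X ≤ k) →
                 (∀ f → Σ (List (V G × V H)) λ X → IsGPSet (Sierpinski G H f) X × k ≤ length X) →
                 LowerGPS G H k
lowerGPS-intro {G} {H} {k} f₀ gp≤k large-gp = (f₀ , attained , gp≤k) , λ f _ gpNumber → below f (proj₂ gpNumber)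
  where
  attained : Σ (List (V G × V H)) λ X → IsGPSet (Sierpinski G H f₀) X × length X ≡ k
  attained with large-gp f₀
  ... | X₀ , X₀-gp , k≤|X₀| = X₀ , X₀-gp , ≤-antisym (gp≤k X₀ X₀-gp) k≤|X₀|
  below : ∀ f {k′} → (∀ X → IsGPSet (Sierpinski G H f) X → length X ≤ k′) → k ≤ k′
  below f gp≤k′ with large-gp f
  ... | X , X-gp , k≤|X| = ≤-trans k≤|X| (gp≤k′ X X-gp)

m+m≤2+n : 2 ≤ m → 2 * m ∸ 2 ≤ n → m + m ≤ 2 + n
m+m≤2+n {m} {n} 2≤m 2m∸2≤n = begin
  m + m          ≡⟨ cong (m +_) (+-identityʳ m) ⟨
  2 * m          ≡⟨ m∸n+n≡m (≤-trans 2≤m (m≤m+n m (m + 0))) ⟨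
  2 * m ∸ 2 + 2  ≤⟨ +-monoˡ-≤ 2 2m∸2≤n ⟩
  n + 2          ≡⟨ +-comm n 2 ⟩
  2 + n          ∎
  where open ≤-Reasoning

2m∸2≤n⇒m≤n : 2 ≤ m → 2 * m ∸ 2 ≤ n → m ≤ n
2m∸2≤n⇒m≤n {m} {n} 2≤m 2m∸2≤n = +-cancelˡ-≤ 2 m n (≤-trans (+-monoˡ-≤ m 2≤m) (m+m≤2+n 2≤m 2m∸2≤n))

2m∸2≤m+r⇒m≤2+r : 2 ≤ m → 2 * m ∸ 2 ≤ m + r → m ≤ 2 + r
2m∸2≤m+r⇒m≤2+r {m} {r} 2≤m 2m∸2≤m+r =
  +-cancelˡ-≤ m m (2 + r) (≤-trans (m+m≤2+n 2≤m 2m∸2≤m+r) (≤-reflexive (x∙yz≈y∙xz 2 m r)))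

theorem5p3 : ∀ (m n : ℕ) → 2 ≤ m → 2 * m ∸ 2 ≤ n →
    LowerGPS (K m) (K n) (m * (n + 1 ∸ m))
theorem5p3 m n 2≤m 2m∸2≤n with m≤n⇒∃[o]m+o≡n (2m∸2≤n⇒m≤n 2≤m 2m∸2≤n)
... | r , refl = lowerGPS-intro (_↑ˡ r) upper lower
  where
  m+r+1∸m≡1+r : m + r + 1 ∸ m ≡ suc r
  m+r+1∸m≡1+r = trans (cong (_∸ m) (+-assoc m r 1)) (trans (m+n∸m≡n m (r + 1)) (+-comm r 1))
  upper : ∀ X → IsGPSet (K⊗K (_↑ˡ r)) X → length X ≤ m * (m + r + 1 ∸ m)
  upper X X-gp = subst (λ k → length X ≤ m * k) (sym m+r+1∸m≡1+r)
                       (gp-length≤ X-gp (2m∸2≤m+r⇒m≤2+r 2≤m 2m∸2≤n))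
  lower : ∀ f → Σ (List (Fin m × Fin (m + r))) λ X → IsGPSet (K⊗K f) X × m * (m + r + 1 ∸ m) ≤ length X
  lower f = nonBridgeVertices f , nonBridgeVertices-gp f , nonBridgeVertices-length f
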